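{- For all positive integers $n, k$, we have $d(nk-1) \geq d(n-1)$.
   Context: For a finite simple graph $G=(V,E)$ and $v \in V$, let $N[v]$ be the closed neighborhood of $v$. Define the map $\Phi_G$ on subsets of $V$ by $\Phi_G(S) = \{v \in V : \lvert N[v]\cap S\rvert \text{ is odd}\}$; it is linear over $\mathbb{F}_2$ when subsets are identified with vectors in $\mathbb{F}_2^V$ (with symmetric difference as addition). For $m \geq 1$, $d(m)$ denotes $\dim_{\mathbb{F}_2} \ker \Phi_G$ where $G$ is the $m \times m$ grid graph (vertices are the cells of an $m\times m$ array, adjacent when they share a side); the empty $0\times 0$ grid has $d(0)=0$. -}

module Defs where

open import Data.Nat using (ℕ; _+_; _∸_; _≤ᵇ_)
open import Data.Fin using (Fin; toℕ)
open import Data.Fin.Base using ()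
open import Data.Bool using (Bool; true; false; _∧_; _xor_)
open import Data.List using (List; foldr; map; allFin; cartesianProduct)
open import Data.Product using (_×_; _,_; Σ)
open import Relation.Binary.PropositionalEquality using (_≡_)

Cell : ℕ → Set
Cell m = Fin m × Fin m

dist : ℕ → ℕ → ℕ
dist a b = (a ∸ b) + (b ∸ a)

-- u ∈ N[v] in the grid graph: u = v or u and v share a side,
-- i.e. Manhattan distance ≤ 1.
inClosedNbhd : ∀ {m} → Cell m → Cell m → Bool
inClosedNbhd (i , j) (i' , j') = (dist (toℕ i) (toℕ i') + dist (toℕ j) (toℕ j')) ≤ᵇ 1

-- Subsets of the vertex set, identified with vectors in 𝔽₂^V.
Vect : ℕ → Set
Vect m = Cell m → Bool

allCells : ∀ m → List (Cell m)
allCells m = cartesianProduct (allFin m) (allFin m)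

parity : List Bool → Bool
parity = foldr _xor_ false

Φ : ∀ {m} → Vect m → Vect m
Φ {m} S v = parity (map (λ u → inClosedNbhd v u ∧ S u) (allCells m))

zeroV : ∀ {m} → Vect m
zeroV _ = false

_⊕_ : ∀ {m} → Vect m → Vect m → Vect m
(x ⊕ y) v = x v xor y v

linComb : ∀ {m d} → (Fin d → Bool) → (Fin d → Vect m) → Vect m
linComb {m} {d} c b v = parity (map (λ i → c i ∧ b i v) (allFin d))

InKer : ∀ {m} → Vect m → Set
InKer x = ∀ v → Φ x v ≡ false

IsKerBasis : ∀ {m d} → (Fin d → Vect m) → Set
IsKerBasis {m} {d} b =
  ((i : Fin d) → InKer (b i))
  × (((c : Fin d → Bool) → (∀ v → linComb c b v ≡ false) → ∀ i → c i ≡ false))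
  × ((x : Vect m) → InKer x → Σ (Fin d → Bool) λ c → ∀ v → linComb c b v ≡ x v)

-- d(m) = dim ker Φ_G for the m × m grid:  KerDim m d  means dim = d,
-- i.e. ker Φ has a basis with exactly d elements.
KerDim : ℕ → ℕ → Set
KerDim m d = Σ (Fin d → Vect m) IsKerBasis

{-# OPTIONS --safe #-}
-- A kernel vector x of the m × m grid, padded by a zero border (rows and columns 0 and n = m + 1),
-- extends to the (nk − 1) × (nk − 1) grid by reflecting it in the zero lines at the multiples of n:
-- the extension reads the padded x at (w P , w Q), where w is the triangle wave of period 2n.
-- Around any cell, w runs through three consecutive values (possibly in reverse), or it turns at a
-- zero line.  In the first case Φ of the extension there equals Φ x at a cell of the small grid; in
-- the second the terms of the plus-shaped stencil cancel in pairs.  So the extension maps ker Φ into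
-- ker Φ, injectively since it restricts to x in the corner, and a counting argument compares dimensions.

module Submission where

open import Defs
open import Data.Bool using (Bool; true; false; not; _∧_; _xor_)
open import Data.Bool.Properties
  using (xor-assoc; xor-comm; xor-same; xor-identityʳ; ∧-zeroʳ; ∧-distribˡ-xor; ∧-distribʳ-xor)
open import Data.Bool.Solver using (module xor-∧-Solver)
open import Data.Fin using (Fin; zero; suc; toℕ; fromℕ<; inject≤; combine; funToFin; finToFun)
open import Data.Fin.Properties
  using (toℕ<n; toℕ-fromℕ<; toℕ-inject≤; 2↔Bool; funToFin-finToFin; finToFun-funToFin; injective⇒≤)
open import Data.List using (List; []; _∷_; _++_; map; allFin; cartesianProduct)
open import Data.List.Properties using (map-++; map-cong; map-∘; map-tabulate)
open import Data.Nat using (ℕ; zero; suc; _+_; _*_; _∸_; _^_; _≤_; _<_; _≡ᵇ_; _≤ᵇ_; z≤n; s≤s)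
open import Data.Nat.Properties
  using (+-suc; +-identityʳ; *-comm; <⇒≤; <⇒≱; ≮⇒≥; n<1+n; m≤m+n; m≤n+m; m≤m*n; ≤-trans; m+[n∸m]≡n; ^-monoʳ-<)
open import Data.Product using (Σ; _×_; _,_; proj₁; proj₂)
open import Data.Sum using (_⊎_; inj₁; inj₂)
open import Function using (_∘_; Inverse)
open import Relation.Binary.PropositionalEquality

open xor-∧-Solver using (solve; _:=_; _:+_; _:*_)

parity-++ : (xs ys : List Bool) → parity (xs ++ ys) ≡ parity xs xor parity ys
parity-++ []       ys = refl
parity-++ (x ∷ xs) ys = trans (cong (x xor_) (parity-++ xs ys)) (sym (xor-assoc x _ _))

module _ {A : Set} where

  parity-map-cong : {f g : A → Bool} → f ≗ g → (xs : List A) →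
                    parity (map f xs) ≡ parity (map g xs)
  parity-map-cong f≗g xs = cong parity (map-cong f≗g xs)

  parity-map-false : (xs : List A) → parity (map (λ _ → false) xs) ≡ false
  parity-map-false []       = refl
  parity-map-false (_ ∷ xs) = parity-map-false xs

  parity-map-xor : (f g : A → Bool) (xs : List A) →
                   parity (map (λ x → f x xor g x) xs) ≡ parity (map f xs) xor parity (map g xs)
  parity-map-xor f g []       = refl
  parity-map-xor f g (x ∷ xs) =
    trans (cong ((f x xor g x) xor_) (parity-map-xor f g xs)) (interchange (f x) (g x) _ _)
    where
    interchange : ∀ a b c d → (a xor b) xor (c xor d) ≡ (a xor c) xor (b xor d)
    interchange = solve 4 (λ a b c d → (a :+ b) :+ (c :+ d) := (a :+ c) :+ (b :+ d)) refl

  parity-map-∧ˡ : (c : Bool) (f : A → Bool) (xs : List A) →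
                  parity (map (λ x → c ∧ f x) xs) ≡ c ∧ parity (map f xs)
  parity-map-∧ˡ c f []       = sym (∧-zeroʳ c)
  parity-map-∧ˡ c f (x ∷ xs) =
    trans (cong ((c ∧ f x) xor_) (parity-map-∧ˡ c f xs)) (sym (∧-distribˡ-xor c (f x) _))

  parity-∧-xor : (p q g : A → Bool) (xs : List A) →
                 parity (map (λ x → (p x xor q x) ∧ g x) xs)
                 ≡ parity (map (λ x → p x ∧ g x) xs) xor parity (map (λ x → q x ∧ g x) xs)
  parity-∧-xor p q g xs =
    trans (parity-map-cong (λ x → ∧-distribʳ-xor (g x) (p x) (q x)) xs) (parity-map-xor _ _ xs)

module _ {A B : Set} where

  parity-swap : (f : A → B → Bool) (xs : List A) (ys : List B) →
                parity (map (λ x → parity (map (f x) ys)) xs)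
                ≡ parity (map (λ y → parity (map (λ x → f x y) xs)) ys)
  parity-swap f []       ys = sym (parity-map-false ys)
  parity-swap f (x ∷ xs) ys =
    trans (cong (parity (map (f x) ys) xor_) (parity-swap f xs ys)) (sym (parity-map-xor (f x) _ ys))

  parity-cartesianProduct : (f : A × B → Bool) (xs : List A) (ys : List B) →
    parity (map f (cartesianProduct xs ys)) ≡ parity (map (λ x → parity (map (λ y → f (x , y)) ys)) xs)
  parity-cartesianProduct f []       ys = refl
  parity-cartesianProduct f (x ∷ xs) ys = begin
      parity (map f (map (x ,_) ys ++ cartesianProduct xs ys))
    ≡⟨ cong parity (map-++ f (map (x ,_) ys) _) ⟩
      parity (map f (map (x ,_) ys) ++ map f (cartesianProduct xs ys))
    ≡⟨ parity-++ (map f (map (x ,_) ys)) _ ⟩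
      parity (map f (map (x ,_) ys)) xor parity (map f (cartesianProduct xs ys))
    ≡⟨ cong₂ _xor_ (cong parity (sym (map-∘ ys))) (parity-cartesianProduct f xs ys) ⟩
      parity (map (λ y → f (x , y)) ys) xor parity (map (λ x → parity (map (λ y → f (x , y)) ys)) xs)
    ∎
    where open ≡-Reasoning

parity-allFin-suc : ∀ {m} (f : Fin (suc m) → Bool) →
                    parity (map f (allFin (suc m))) ≡ f zero xor parity (map (f ∘ suc) (allFin m))
parity-allFin-suc {m} f =
  cong (λ xs → f zero xor parity xs) (trans (map-tabulate suc f) (sym (map-tabulate (λ i → i) (f ∘ suc))))

index : ∀ {m} → (Fin m → Bool) → ℕ → Bool
index {zero}  g t       = false
index {suc m} g zero    = g zero
index {suc m} g (suc t) = index (g ∘ suc) t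

-- pad g T is g at T − 1, and false outside 1 … m: the zero border of the grid.
pad : ∀ {m} → (Fin m → Bool) → ℕ → Bool
pad g zero    = false
pad g (suc t) = index g t

padGrid : ∀ {m} → Vect m → ℕ → ℕ → Bool
padGrid x A B = pad (λ i → pad (λ j → x (i , j)) B) A

index-toℕ : ∀ {m} (g : Fin m → Bool) (i : Fin m) → index g (toℕ i) ≡ g i
index-toℕ g zero    = refl
index-toℕ g (suc i) = index-toℕ (g ∘ suc) i

index-beyond : ∀ {m} (g : Fin m → Bool) → index g m ≡ false
index-beyond {zero}  g = refl
index-beyond {suc m} g = index-beyond (g ∘ suc)

index-cong : ∀ {m} {f g : Fin m → Bool} → f ≗ g → ∀ t → index f t ≡ index g t
index-cong {zero}  f≗g t       = refl
index-cong {suc m} f≗g zero    = f≗g zero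
index-cong {suc m} f≗g (suc t) = index-cong (f≗g ∘ suc) t

index-false : ∀ {m} t → index {m} (λ _ → false) t ≡ false
index-false {zero}  t       = refl
index-false {suc m} zero    = refl
index-false {suc m} (suc t) = index-false {m} t

index-xor : ∀ {m} (f g : Fin m → Bool) t → index (λ i → f i xor g i) t ≡ index f t xor index g t
index-xor {zero}  f g t       = refl
index-xor {suc m} f g zero    = refl
index-xor {suc m} f g (suc t) = index-xor (f ∘ suc) (g ∘ suc) t

index-tabulate : ∀ {m} (h : ℕ → Bool) {t} → t ≤ m → h m ≡ false → index {m} (h ∘ toℕ) t ≡ h t
index-tabulate {zero}  h z≤n       hm = sym hm
index-tabulate {suc m} h {zero} _  hm = refl
index-tabulate {suc m} h (s≤s t≤m) hm = index-tabulate (h ∘ suc) t≤m hm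

pad-cong : ∀ {m} {f g : Fin m → Bool} → f ≗ g → ∀ T → pad f T ≡ pad g T
pad-cong f≗g zero    = refl
pad-cong f≗g (suc t) = index-cong f≗g t

pad-false : ∀ {m} T → pad {m} (λ _ → false) T ≡ false
pad-false zero    = refl
pad-false {m} (suc t) = index-false {m} t

pad-xor : ∀ {m} (f g : Fin m → Bool) T → pad (λ i → f i xor g i) T ≡ pad f T xor pad g T
pad-xor f g zero    = refl
pad-xor f g (suc t) = index-xor f g t

pad-tabulate : ∀ {m} (h : ℕ → Bool) {T} → T ≤ suc m → h 0 ≡ false → h (suc m) ≡ false →
               pad {m} (h ∘ suc ∘ toℕ) T ≡ h T
pad-tabulate h {zero}  _         h0 _  = sym h0
pad-tabulate h {suc t} (s≤s t≤m) _  hm = index-tabulate (h ∘ suc) t≤m hm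

parity-select-index : ∀ {m} (g : Fin m → Bool) t →
                      parity (map (λ i → (toℕ i ≡ᵇ t) ∧ g i) (allFin m)) ≡ index g t
parity-select-index {zero}  g t       = refl
parity-select-index {suc m} g zero    = begin
    parity (map (λ i → (toℕ i ≡ᵇ 0) ∧ g i) (allFin (suc m)))
  ≡⟨ parity-allFin-suc (λ i → (toℕ i ≡ᵇ 0) ∧ g i) ⟩
    g zero xor parity (map (λ _ → false) (allFin m))
  ≡⟨ cong (g zero xor_) (parity-map-false (allFin m)) ⟩
    g zero xor false
  ≡⟨ xor-identityʳ (g zero) ⟩
    g zero
  ∎
  where open ≡-Reasoning
parity-select-index {suc m} g (suc t) =
  trans (parity-allFin-suc (λ i → (toℕ i ≡ᵇ suc t) ∧ g i)) (parity-select-index (g ∘ suc) t)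

parity-select : ∀ {m} (g : Fin m → Bool) T →
                parity (map (λ i → (suc (toℕ i) ≡ᵇ T) ∧ g i) (allFin m)) ≡ pad g T
parity-select {m} g zero    = parity-map-false (allFin m)
parity-select {m} g (suc t) = parity-select-index g t

same adjacent near : ℕ → ℕ → Bool
same     a a' = suc a' ≡ᵇ suc a
adjacent a a' = (suc a' ≡ᵇ a) xor (suc a' ≡ᵇ suc (suc a))
near     a a' = same a a' xor adjacent a a'

≤ᵇ1-split : ∀ x → (x ≤ᵇ 1) ≡ (x ≡ᵇ 0) xor (x ≡ᵇ 1)
≤ᵇ1-split zero          = refl
≤ᵇ1-split (suc zero)    = refl
≤ᵇ1-split (suc (suc x)) = refl

+-≤ᵇ1 : ∀ x y → (x + y ≤ᵇ 1) ≡ ((x ≡ᵇ 0) ∧ (y ≤ᵇ 1)) xor ((x ≡ᵇ 1) ∧ (y ≡ᵇ 0))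
+-≤ᵇ1 zero          y       = sym (xor-identityʳ _)
+-≤ᵇ1 (suc zero)    zero    = refl
+-≤ᵇ1 (suc zero)    (suc y) = refl
+-≤ᵇ1 (suc (suc x)) y       = refl

dist≡ᵇ0 : ∀ x y → (dist x y ≡ᵇ 0) ≡ (y ≡ᵇ x)
dist≡ᵇ0 zero    zero    = refl
dist≡ᵇ0 zero    (suc y) = refl
dist≡ᵇ0 (suc x) zero    = refl
dist≡ᵇ0 (suc x) (suc y) = dist≡ᵇ0 x y

dist≡ᵇ1 : ∀ x y → (dist x y ≡ᵇ 1) ≡ (suc y ≡ᵇ x) xor (y ≡ᵇ suc x)
dist≡ᵇ1 zero          zero          = refl
dist≡ᵇ1 zero          (suc zero)    = refl
dist≡ᵇ1 zero          (suc (suc y)) = refl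
dist≡ᵇ1 (suc zero)    zero          = refl
dist≡ᵇ1 (suc (suc x)) zero          = refl
dist≡ᵇ1 (suc x)       (suc y)       = dist≡ᵇ1 x y

closedNbhd-split : ∀ a c a' c' →
  ((dist a a' + dist c c') ≤ᵇ 1) ≡ (same a a' ∧ near c c') xor (adjacent a a' ∧ same c c')
closedNbhd-split a c a' c'
  rewrite +-≤ᵇ1 (dist a a') (dist c c') | ≤ᵇ1-split (dist c c')
        | dist≡ᵇ0 a a' | dist≡ᵇ0 c c' | dist≡ᵇ1 a a' | dist≡ᵇ1 c c' = refl

module _ {m} (g : Fin m → Bool) (c : ℕ) where

  parity-adjacent : parity (map (λ j → adjacent c (toℕ j) ∧ g j) (allFin m))
                    ≡ pad g c xor pad g (suc (suc c))
  parity-adjacent =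
    trans (parity-∧-xor _ _ g (allFin m)) (cong₂ _xor_ (parity-select g c) (parity-select g (suc (suc c))))

  parity-near : parity (map (λ j → near c (toℕ j) ∧ g j) (allFin m))
                ≡ pad g (suc c) xor (pad g c xor pad g (suc (suc c)))
  parity-near =
    trans (parity-∧-xor _ _ g (allFin m)) (cong₂ _xor_ (parity-select g (suc c)) parity-adjacent)

Window : Set
Window = ℕ × ℕ × ℕ

run : ℕ → Window
run a = a , suc a , suc (suc a)

-- The sum of f over the plus-shaped stencil with centre (ya , yc) and arms xa, za and xc, zc.
cross : (ℕ → ℕ → Bool) → Window → Window → Bool
cross f (xa , ya , za) (xc , yc , zc) = (f ya yc xor (f ya xc xor f ya zc)) xor (f xa yc xor f za yc)

module _ {m} (S : Vect m) (i j : Fin m) where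

  private
    a c : ℕ
    a = toℕ i
    c = toℕ j

    row : Fin m → Fin m → Bool
    row i' j' = S (i' , j')

    left middle right nearRow : Fin m → Bool
    left    i' = pad (row i') c
    middle  i' = pad (row i') (suc c)
    right   i' = pad (row i') (suc (suc c))
    nearRow i' = middle i' xor (left i' xor right i')

    regroup : ∀ σ ν α δ s → ((σ ∧ ν) xor (α ∧ δ)) ∧ s ≡ (σ ∧ (ν ∧ s)) xor (α ∧ (δ ∧ s))
    regroup = solve 5 (λ σ ν α δ s → ((σ :* ν) :+ (α :* δ)) :* s := (σ :* (ν :* s)) :+ (α :* (δ :* s))) refl

    parity-closedNbhd-row : ∀ i' →
      parity (map (λ j' → inClosedNbhd (i , j) (i' , j') ∧ S (i' , j')) (allFin m))
      ≡ (same a (toℕ i') ∧ nearRow i') xor (adjacent a (toℕ i') ∧ middle i')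
    parity-closedNbhd-row i' = begin
        parity (map (λ j' → inClosedNbhd (i , j) (i' , j') ∧ S (i' , j')) (allFin m))
      ≡⟨ parity-map-cong (λ j' → trans (cong (_∧ S (i' , j')) (closedNbhd-split a c (toℕ i') (toℕ j')))
                                       (regroup σ (near c (toℕ j')) α (same c (toℕ j')) (row i' j'))) (allFin m) ⟩
        parity (map (λ j' → (σ ∧ (near c (toℕ j') ∧ row i' j')) xor (α ∧ (same c (toℕ j') ∧ row i' j'))) (allFin m))
      ≡⟨ parity-map-xor _ _ (allFin m) ⟩
        parity (map (λ j' → σ ∧ (near c (toℕ j') ∧ row i' j')) (allFin m))
          xor parity (map (λ j' → α ∧ (same c (toℕ j') ∧ row i' j')) (allFin m))
      ≡⟨ cong₂ _xor_ (parity-map-∧ˡ σ _ (allFin m)) (parity-map-∧ˡ α _ (allFin m)) ⟩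
        (σ ∧ parity (map (λ j' → near c (toℕ j') ∧ row i' j') (allFin m)))
          xor (α ∧ parity (map (λ j' → same c (toℕ j') ∧ row i' j') (allFin m)))
      ≡⟨ cong₂ (λ u v → (σ ∧ u) xor (α ∧ v)) (parity-near (row i') c) (parity-select (row i') (suc c)) ⟩
        (σ ∧ nearRow i') xor (α ∧ middle i')
      ∎
      where
      open ≡-Reasoning
      σ α : Bool
      σ = same a (toℕ i')
      α = adjacent a (toℕ i')

  Φ≡cross : Φ S (i , j) ≡ cross (padGrid S) (run (toℕ i)) (run (toℕ j))
  Φ≡cross = begin
      Φ S (i , j)
    ≡⟨ parity-cartesianProduct _ (allFin m) (allFin m) ⟩
      parity (map (λ i' → parity (map (λ j' → inClosedNbhd (i , j) (i' , j') ∧ S (i' , j')) (allFin m))) (allFin m))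
    ≡⟨ parity-map-cong parity-closedNbhd-row (allFin m) ⟩
      parity (map (λ i' → (same a (toℕ i') ∧ nearRow i') xor (adjacent a (toℕ i') ∧ middle i')) (allFin m))
    ≡⟨ parity-map-xor _ _ (allFin m) ⟩
      parity (map (λ i' → same a (toℕ i') ∧ nearRow i') (allFin m))
        xor parity (map (λ i' → adjacent a (toℕ i') ∧ middle i') (allFin m))
    ≡⟨ cong₂ _xor_ (parity-select nearRow (suc a)) (parity-adjacent middle a) ⟩
      pad nearRow (suc a) xor (pad middle a xor pad middle (suc (suc a)))
    ≡⟨ cong (_xor (pad middle a xor pad middle (suc (suc a))))
            (trans (pad-xor middle (λ i' → left i' xor right i') (suc a))
                   (cong (pad middle (suc a) xor_) (pad-xor left right (suc a)))) ⟩
      cross (padGrid S) (run a) (run c)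
    ∎
    where open ≡-Reasoning

Border : ℕ → ℕ → Set
Border n y = y ≡ 0 ⊎ y ≡ n

-- The shapes of the images of three consecutive coordinates under a triangle wave turning at 0 and n.
data Folded (n : ℕ) : Window → Set where
  reflected  : ∀ {x y} → Border n y → Folded n (x , y , x)
  ascending  : ∀ {a} → suc a < n → Folded n (a , suc a , suc (suc a))
  descending : ∀ {a} → suc a < n → Folded n (suc (suc a) , suc a , a)

module _ {n} (f : ℕ → ℕ → Bool)
         (row-border : ∀ {y} → Border n y → ∀ B → f y B ≡ false)
         (column-border : ∀ {y} → Border n y → ∀ A → f A y ≡ false)
         (interior : ∀ {a c} → suc a < n → suc c < n → cross f (run a) (run c) ≡ false) where

  private
    cross-flipˡ : ∀ {x y z} t → cross f (z , y , x) t ≡ cross f (x , y , z) t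
    cross-flipˡ {x} {y} {z} (xc , yc , zc) =
      cong ((f y yc xor (f y xc xor f y zc)) xor_) (xor-comm (f z yc) (f x yc))

    cross-flipʳ : ∀ {x y z} t → cross f t (z , y , x) ≡ cross f t (x , y , z)
    cross-flipʳ {x} {y} {z} (xa , ya , za) =
      cong (λ u → (f ya y xor u) xor (f xa y xor f za y)) (xor-comm (f ya z) (f ya x))

    cross-reflectedˡ : ∀ {x y} → Border n y → ∀ t → cross f (x , y , x) t ≡ false
    cross-reflectedˡ {x} {y} b (xc , yc , zc)
      rewrite row-border b yc | row-border b xc | row-border b zc = xor-same (f x yc)

    cross-reflectedʳ : ∀ {x y} → Border n y → ∀ t → cross f t (x , y , x) ≡ false
    cross-reflectedʳ {x} {y} b (xa , ya , za)
      rewrite column-border b ya | column-border b xa | column-border b za = cong (_xor false) (xor-same (f ya x))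

  cross-folded : ∀ {t t'} → Folded n t → Folded n t' → cross f t t' ≡ false
  cross-folded (reflected b)  t'             = cross-reflectedˡ b _
  cross-folded (ascending _)  (reflected b)  = cross-reflectedʳ b _
  cross-folded (descending _) (reflected b)  = cross-reflectedʳ b _
  cross-folded (ascending p)  (ascending q)  = interior p q
  cross-folded (descending p) (ascending q)  = trans (cross-flipˡ _) (interior p q)
  cross-folded (ascending p)  (descending q) = trans (cross-flipʳ _) (interior p q)
  cross-folded (descending p) (descending q) = trans (cross-flipˡ _) (trans (cross-flipʳ _) (interior p q))

-- A phase (r , d , up) is r steps past the last turn and d steps before the next one.
Phase : Set
Phase = ℕ × ℕ × Bool

tick : Phase → Phase
tick (r , suc d , up) = suc r , d , up
tick (r , zero  , up) = zero , r , not up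

height : Phase → ℕ
height (r , d , true)  = r
height (r , d , false) = suc d

span : Phase → ℕ
span (r , d , _) = d + r

phase : ℕ → ℕ → Phase
phase m zero    = zero , m , true
phase m (suc p) = tick (phase m p)

-- The triangle wave 0, 1, …, m, m+1, m, …, 1, 0, 1, … of period 2(m+1).
wave : ℕ → ℕ → ℕ
wave m p = height (phase m p)

span-tick : ∀ s → span (tick s) ≡ span s
span-tick (r , suc d , _) = +-suc d r
span-tick (r , zero  , _) = +-identityʳ r

span-phase : ∀ m p → span (phase m p) ≡ m
span-phase m zero    = +-identityʳ m
span-phase m (suc p) = trans (span-tick (phase m p)) (span-phase m p)

heights-folded : ∀ s → Folded (suc (span s)) (height s , height (tick s) , height (tick (tick s)))
heights-folded (zero  , zero        , true)  = reflected (inj₂ refl)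
heights-folded (suc r , zero        , true)  = reflected (inj₂ refl)
heights-folded (zero  , zero        , false) = reflected (inj₁ refl)
heights-folded (suc r , zero        , false) = reflected (inj₁ refl)
heights-folded (r     , suc zero    , true)  = ascending (n<1+n (suc r))
heights-folded (r     , suc zero    , false) = descending (s≤s (s≤s z≤n))
heights-folded (r     , suc (suc d) , true)  = ascending (s≤s (s≤s (m≤n+m r (suc d))))
heights-folded (r     , suc (suc d) , false) = descending (s≤s (s≤s (s≤s (m≤m+n d r))))

waveWindow : ℕ → ℕ → Window
waveWindow m p = wave m p , wave m (suc p) , wave m (suc (suc p))

wave-folded : ∀ m p → Folded (suc m) (waveWindow m p)
wave-folded m p = subst (λ k → Folded (suc k) (waveWindow m p)) (span-phase m p) (heights-folded (phase m p))

phase-below : ∀ p d → phase (p + d) p ≡ (p , d , true)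
phase-below zero    d = refl
phase-below (suc p) d =
  cong tick (subst (λ m → phase m p ≡ (p , suc d , true)) (+-suc p d) (phase-below p (suc d)))

wave-below : ∀ {m p} → p ≤ m → wave m p ≡ p
wave-below {m} {p} p≤m =
  cong height (subst (λ m' → phase m' p ≡ (p , m ∸ p , true)) (m+[n∸m]≡n p≤m) (phase-below p (m ∸ p)))

phase-turn : ∀ m p {r} d {up} → phase m p ≡ (r , d , up) → phase m (suc d + p) ≡ (0 , d + r , not up)
phase-turn m p zero    eq = cong tick eq
phase-turn m p {r} (suc d) {up} eq = begin
    phase m (suc (suc d + p))
  ≡⟨ cong (phase m) (sym (+-suc (suc d) p)) ⟩
    phase m (suc d + suc p)
  ≡⟨ phase-turn m (suc p) d (cong tick eq) ⟩
    (0 , d + suc r , not up)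
  ≡⟨ cong (λ k → 0 , k , not up) (+-suc d r) ⟩
    (0 , suc d + r , not up)
  ∎
  where open ≡-Reasoning

phase-multiple : ∀ m K → Σ Bool λ up → phase m (K * suc m) ≡ (0 , m , up)
phase-multiple m zero = true , refl
phase-multiple m (suc K) with phase-multiple m K
... | up , eq = not up , trans (phase-turn m (K * suc m) m eq) (cong (λ k → 0 , k , not up) (+-identityʳ m))

wave-multiple : ∀ m K → Border (suc m) (wave m (K * suc m))
wave-multiple m K with phase-multiple m K
... | true  , eq = inj₁ (cong height eq)
... | false , eq = inj₂ (cong height eq)

module _ {m} (x : Vect m) where

  padGrid-row-border : ∀ {A} → Border (suc m) A → ∀ B → padGrid x A B ≡ false
  padGrid-row-border (inj₁ refl) B = refl
  padGrid-row-border (inj₂ refl) B = index-beyond (λ i → pad (λ j → x (i , j)) B)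

  padGrid-column-border : ∀ {B} → Border (suc m) B → ∀ A → padGrid x A B ≡ false
  padGrid-column-border (inj₁ refl) A = pad-false A
  padGrid-column-border (inj₂ refl) A = trans (pad-cong (λ i → index-beyond (λ j → x (i , j))) A) (pad-false A)

  padGrid-suc : ∀ i j → padGrid x (suc (toℕ i)) (suc (toℕ j)) ≡ x (i , j)
  padGrid-suc i j = trans (index-toℕ _ i) (index-toℕ _ j)

  InKer⇒cross : InKer x → ∀ {a c} → a < m → c < m → cross (padGrid x) (run a) (run c) ≡ false
  InKer⇒cross x∈ker a<m c<m =
    subst₂ (λ a c → cross (padGrid x) (run a) (run c) ≡ false) (toℕ-fromℕ< a<m) (toℕ-fromℕ< c<m)
      (trans (sym (Φ≡cross x (fromℕ< a<m) (fromℕ< c<m))) (x∈ker _))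

  cross-padGrid-folded : InKer x → ∀ {t t'} → Folded (suc m) t → Folded (suc m) t' → cross (padGrid x) t t' ≡ false
  cross-padGrid-folded x∈ker = cross-folded (padGrid x) padGrid-row-border padGrid-column-border interior
    where
    interior : ∀ {a c} → suc a < suc m → suc c < suc m → cross (padGrid x) (run a) (run c) ≡ false
    interior (s≤s a<m) (s≤s c<m) = InKer⇒cross x∈ker a<m c<m

cross-run-cong : ∀ {N} {f g : ℕ → ℕ → Bool} → (∀ {A B} → A ≤ N → B ≤ N → f A B ≡ g A B) →
                 ∀ {a c} → suc a < N → suc c < N → cross f (run a) (run c) ≡ cross g (run a) (run c)
cross-run-cong f≈g a+2≤N c+2≤N =
  cong₂ _xor_ (cong₂ _xor_ (f≈g a+1≤N c+1≤N) (cong₂ _xor_ (f≈g a+1≤N c≤N) (f≈g a+1≤N c+2≤N)))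
              (cong₂ _xor_ (f≈g a≤N c+1≤N) (f≈g a+2≤N c+1≤N))
  where
  a+1≤N = <⇒≤ a+2≤N
  c+1≤N = <⇒≤ c+2≤N
  a≤N   = <⇒≤ a+1≤N
  c≤N   = <⇒≤ c+1≤N

module Extension (m k : ℕ) where

  -- M = (m + 1)(k + 1) − 1
  M : ℕ
  M = k + m * suc k

  extend : Vect m → Vect M
  extend x (i , j) = padGrid x (wave m (suc (toℕ i))) (wave m (suc (toℕ j)))

  wave-end : Border (suc m) (wave m (suc M))
  wave-end = subst (Border (suc m) ∘ wave m) (*-comm (suc k) (suc m)) (wave-multiple m (suc k))

  padGrid-extend : ∀ x {P Q} → P ≤ suc M → Q ≤ suc M → padGrid (extend x) P Q ≡ padGrid x (wave m P) (wave m Q)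
  padGrid-extend x {P} {Q} P≤ Q≤ =
    trans (pad-cong (λ i → pad-tabulate (λ B → padGrid x (wave m (suc (toℕ i))) (wave m B)) Q≤
                             (padGrid-column-border x (inj₁ refl) (rowImage i)) (padGrid-column-border x wave-end (rowImage i))) P)
          (pad-tabulate (λ A → padGrid x (wave m A) (wave m Q)) P≤ refl (padGrid-row-border x wave-end (wave m Q)))
    where
    rowImage : Fin M → ℕ
    rowImage i = wave m (suc (toℕ i))

  InKer-extend : ∀ x → InKer x → InKer (extend x)
  InKer-extend x x∈ker (i , j) = begin
      Φ (extend x) (i , j)
    ≡⟨ Φ≡cross (extend x) i j ⟩
      cross (padGrid (extend x)) (run (toℕ i)) (run (toℕ j))
    ≡⟨ cross-run-cong (padGrid-extend x) (s≤s (toℕ<n i)) (s≤s (toℕ<n j)) ⟩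
      cross (padGrid x) (waveWindow m (toℕ i)) (waveWindow m (toℕ j))
    ≡⟨ cross-padGrid-folded x x∈ker (wave-folded m (toℕ i)) (wave-folded m (toℕ j)) ⟩
      false
    ∎
    where open ≡-Reasoning

  m≤M : m ≤ M
  m≤M = ≤-trans (m≤m*n m (suc k)) (m≤n+m (m * suc k) k)

  extend-corner : ∀ x i j → extend x (inject≤ i m≤M , inject≤ j m≤M) ≡ x (i , j)
  extend-corner x i j
    rewrite toℕ-inject≤ i m≤M | toℕ-inject≤ j m≤M | wave-below (toℕ<n i) | wave-below (toℕ<n j) = padGrid-suc x i j

  extend-injective : ∀ x y → extend x ≗ extend y → x ≗ y
  extend-injective x y eq (i , j) =
    trans (sym (extend-corner x i j)) (trans (eq (inject≤ i m≤M , inject≤ j m≤M)) (extend-corner y i j))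

module _ {m d} (b : Fin d → Vect m) where

  Φ-linComb : ∀ (c : Fin d → Bool) v → Φ (linComb c b) v ≡ parity (map (λ i → c i ∧ Φ (b i) v) (allFin d))
  Φ-linComb c v = begin
      Φ (linComb c b) v
    ≡⟨ parity-map-cong (λ u → sym (parity-map-∧ˡ (inClosedNbhd v u) (λ i → c i ∧ b i u) (allFin d))) (allCells m) ⟩
      parity (map (λ u → parity (map (λ i → inClosedNbhd v u ∧ (c i ∧ b i u)) (allFin d))) (allCells m))
    ≡⟨ parity-swap (λ u i → inClosedNbhd v u ∧ (c i ∧ b i u)) (allCells m) (allFin d) ⟩
      parity (map (λ i → parity (map (λ u → inClosedNbhd v u ∧ (c i ∧ b i u)) (allCells m))) (allFin d))
    ≡⟨ parity-map-cong (λ i → trans (parity-map-cong (λ u → swap∧ (inClosedNbhd v u) (c i) (b i u)) (allCells m))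
                                     (parity-map-∧ˡ (c i) (λ u → inClosedNbhd v u ∧ b i u) (allCells m))) (allFin d) ⟩
      parity (map (λ i → c i ∧ Φ (b i) v) (allFin d))
    ∎
    where
    open ≡-Reasoning
    swap∧ : ∀ p q r → p ∧ (q ∧ r) ≡ q ∧ (p ∧ r)
    swap∧ = solve 3 (λ p q r → p :* (q :* r) := q :* (p :* r)) refl

  InKer-linComb : (∀ i → InKer (b i)) → ∀ c → InKer (linComb c b)
  InKer-linComb b∈ker c v =
    trans (Φ-linComb c v)
      (trans (parity-map-cong (λ i → trans (cong (c i ∧_) (b∈ker i v)) (∧-zeroʳ (c i))) (allFin d))
             (parity-map-false (allFin d)))

  linComb-cong : ∀ {c c'} → c ≗ c' → linComb c b ≗ linComb c' b
  linComb-cong c≗c' v = parity-map-cong (λ i → cong (_∧ b i v) (c≗c' i)) (allFin d)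

  linComb-injective : (∀ c → (∀ v → linComb c b v ≡ false) → ∀ i → c i ≡ false) →
                      ∀ c c' → linComb c b ≗ linComb c' b → c ≗ c'
  linComb-injective independent c c' eq i = xor≡false⇒≡ (independent (λ i → c i xor c' i) difference-vanishes i)
    where
    xor≡false⇒≡ : ∀ {p q} → p xor q ≡ false → p ≡ q
    xor≡false⇒≡ {false} {false} _ = refl
    xor≡false⇒≡ {true}  {true}  _ = refl

    difference-vanishes : ∀ v → linComb (λ i → c i xor c' i) b v ≡ false
    difference-vanishes v =
      trans (parity-∧-xor c c' (λ i → b i v) (allFin d))
            (trans (cong (_xor linComb c' b v) (eq v)) (xor-same (linComb c' b v)))

funToFin-cong : ∀ {m n} {f g : Fin m → Fin n} → f ≗ g → funToFin f ≡ funToFin g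
funToFin-cong {zero}  f≗g = refl
funToFin-cong {suc m} f≗g = cong₂ combine (f≗g zero) (funToFin-cong (f≗g ∘ suc))

-- The binary coding Fin (2 ^ b) ≅ (Fin b → Bool) turns φ into an injection Fin (2 ^ b) → Fin (2 ^ a).
bool-functions-injection⇒≤ : ∀ {a b} (φ : (Fin b → Bool) → (Fin a → Bool)) →
                             (∀ c c' → φ c ≗ φ c' → c ≗ c') → b ≤ a
bool-functions-injection⇒≤ {a} {b} φ φ-injective =
  ≮⇒≥ λ a<b → <⇒≱ (^-monoʳ-< 2 (s≤s (s≤s z≤n)) a<b) (injective⇒≤ code-injective)
  where
  open Inverse 2↔Bool using (to; from; strictlyInverseˡ; strictlyInverseʳ)

  digits : Fin (2 ^ b) → Fin b → Fin 2
  digits = finToFun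

  decode : Fin (2 ^ b) → Fin b → Bool
  decode x = to ∘ digits x

  code : Fin (2 ^ b) → Fin (2 ^ a)
  code x = funToFin (from ∘ φ (decode x))

  code-injective : ∀ {x y} → code x ≡ code y → x ≡ y
  code-injective {x} {y} eq = begin
      x                    ≡⟨ funToFin-finToFin {b} x ⟨
      funToFin (digits x)  ≡⟨ funToFin-cong same-digits ⟩
      funToFin (digits y)  ≡⟨ funToFin-finToFin {b} y ⟩
      y                    ∎
    where
    open ≡-Reasoning
    same-coded-images : from ∘ φ (decode x) ≗ from ∘ φ (decode y)
    same-coded-images i =
      trans (sym (finToFun-funToFin _ i)) (trans (cong (λ z → finToFun z i) eq) (finToFun-funToFin _ i))

    same-images : φ (decode x) ≗ φ (decode y)
    same-images i = trans (sym (strictlyInverseˡ _)) (trans (cong to (same-coded-images i)) (strictlyInverseˡ _))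

    same-digits : digits x ≗ digits y
    same-digits i =
      trans (sym (strictlyInverseʳ _)) (trans (cong from (φ-injective _ _ same-images i)) (strictlyInverseʳ _))

KerDim-mono : ∀ {m M a b} → KerDim m b → KerDim M a → (E : Vect m → Vect M) →
              (∀ x → InKer x → InKer (E x)) → (∀ x y → E x ≗ E y → x ≗ y) → b ≤ a
KerDim-mono {a = a} {b} (β , β∈ker , β-independent , _) (B , _ , _ , B-spans) E E-InKer E-injective =
  bool-functions-injection⇒≤ coordinates coordinates-injective
  where
  image-in-ker : ∀ c → InKer (E (linComb c β))
  image-in-ker c = E-InKer _ (InKer-linComb β β∈ker c)

  coordinates : (Fin b → Bool) → (Fin a → Bool)
  coordinates c = proj₁ (B-spans (E (linComb c β)) (image-in-ker c))

  coordinates-injective : ∀ c c' → coordinates c ≗ coordinates c' → c ≗ c'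
  coordinates-injective c c' eq = linComb-injective β β-independent c c' (E-injective _ _ same-image)
    where
    same-image : E (linComb c β) ≗ E (linComb c' β)
    same-image v = trans (sym (proj₂ (B-spans _ (image-in-ker c)) v))
                         (trans (linComb-cong B eq v) (proj₂ (B-spans _ (image-in-ker c')) v))

theorem2 : (n k : ℕ) → 1 ≤ n → 1 ≤ k →
           (a b : ℕ) → KerDim (n * k ∸ 1) a → KerDim (n ∸ 1) b → b ≤ a
theorem2 (suc m) (suc k) _ _ a b dim-big dim-small =
  KerDim-mono dim-small dim-big extend InKer-extend extend-injective
  where open Extension m k
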